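{- We have $\rho_{\alpha}^{\max}\equiv(\rho_{\beta}^{\max})_{\vert A}$ and $\rho_{\alpha}^{\sqsubseteq}\equiv(\rho_{\beta}^{\sqsubseteq})_{\vert A}$.
   Context: Let $X$ be a set and $(\mathfrak{B},\beta)$ a numbered subbasis for $X$: $\mathfrak{B}\subseteq\mathcal{P}(X)$ countable and $\beta:\subseteq\mathbb{N}\rightarrow\mathfrak{B}$ a partial surjection. Let $\Delta$ be the standard numbering of finite subsets of $\mathbb{N}$; the induced numbered basis $(\hat{\mathfrak{B}},\hat{\beta})$ consists of finite intersections of elements of $\mathfrak{B}$, with $\text{dom}(\hat{\beta})=\{n:\Delta_{n}\subseteq\text{dom}(\beta)\}$ and $\hat{\beta}(n)=\bigcap_{k\in\Delta_{n}}\beta(k)$. A strong inclusion relation $\sqsubseteq$ for $(\hat{\mathfrak{B}},\hat{\beta})$ is a transitive binary relation on $\text{dom}(\hat{\beta})$ such that $b_{1}\sqsubseteq b_{2}\Rightarrow\hat{\beta}(b_{1})\subseteq\hat{\beta}(b_{2})$; it is assumed that every point $x$ admits a strong neighborhood basis, i.e. a set $S\subseteq\text{dom}(\hat{\beta})$ with $x\in\hat{\beta}(b)$ for all $b\in S$ and such that for every $b_{1}\in\text{dom}(\hat{\beta})$ with $x\in\hat{\beta}(b_{1})$ there is $b_{2}\in S$ with $b_{2}\sqsubseteq b_{1}$. Multi-representations $\mathbb{N}^{\mathbb{N}}\rightrightarrows X$: $x\in\rho_{\beta}^{\max}(f)$ iff $\text{Im}(f)=\{n\in\text{dom}(\beta):x\in\beta(n)\}$;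 $x\in\rho_{\beta}^{\sqsubseteq}(f)$ iff $\text{Im}(f)$ is a strong neighborhood basis of $x$ (all elements of $\text{Im}(f)$ lie in $\text{dom}(\hat{\beta})$, contain $x$, and every $\hat{\beta}$-name of a set containing $x$ strongly contains some element of $\text{Im}(f)$). For a subset $A\subseteq X$ and a multi-representation $\rho$ of $X$, the restriction $\rho_{\vert A}$ has domain $\{f\in\text{dom}(\rho):\rho(f)\cap A\neq\emptyset\}$ and $\rho_{\vert A}(f)=\rho(f)\cap A$. The numbered subbasis $(\mathfrak{A},\alpha)$ of $A$ is defined by $\text{dom}(\alpha)=\text{dom}(\beta)$ and $\alpha(n)=A\cap\beta(n)$; it is equipped with the same strong inclusion relation $\sqsubseteq$ (still a strong inclusion for the induced basis of $A$), giving multi-representations $\rho_{\alpha}^{\max}$ and $\rho_{\alpha}^{\sqsubseteq}$ of $A$. Here $\rho_{1}\equiv\rho_{2}$ means that the identity is computable in both directions, i.e. each multi-representation computably translates to the other. -}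

module Defs where

open import Data.Nat using (ℕ; zero; suc; _<_; _%_; _/_; _≡ᵇ_)
open import Data.Bool using (Bool; T)
open import Data.Fin using (Fin)
open import Data.Vec using (Vec; []; _∷_; lookup)
open import Data.Product using (Σ; ∃; _×_; _,_; proj₁)
open import Relation.Binary.PropositionalEquality using (_≡_)

bit : ℕ → ℕ → Bool
bit zero    n = (n % 2) ≡ᵇ 1
bit (suc i) n = bit i (n / 2)

_∈Δ_ : ℕ → ℕ → Set
i ∈Δ n = T (bit i n)

-- Baire space and multi-representations  ℕ^ℕ ⇉ Y
-- (a multi-representation is a relation: ρ f y  means  y ∈ ρ(f);
--  dom ρ = { f | ∃ y. ρ f y }).

Baire : Set
Baire = ℕ → ℕ

MultiRep : Set → Set₁
MultiRep Y = Baire → Y → Set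

Im : Baire → ℕ → Set
Im f n = ∃ λ k → f k ≡ n

-- Restriction ρ_{|A}: a multi-representation of the subset A (as Σ X A);
-- dom(ρ_{|A}) = { f | ρ(f) ∩ A ≠ ∅ },  ρ_{|A}(f) = ρ(f) ∩ A.
restrict : {X : Set} → MultiRep X → (A : X → Set) → MultiRep (Σ X A)
restrict ρ A f y = ρ f (proj₁ y)

-- Numbered subbasis (𝔅, β): β :⊆ ℕ → 𝔅 ⊆ P(X) a partial surjection.
-- We take 𝔅 to be the image of β (so countability and surjectivity are
-- automatic); the partial map is given by its domain and its values.

record NumberedSubbasis (X : Set) : Set₁ where
  field
    dom : ℕ → Set
    β   : ℕ → X → Set      -- β n x  :  x ∈ β(n)   (meaningful for n ∈ dom)

module _ {X : Set} (B : NumberedSubbasis X) where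
  open NumberedSubbasis B

  domβ̂ : ℕ → Set
  domβ̂ n = ∀ k → k ∈Δ n → dom k

  β̂ : ℕ → X → Set
  β̂ n x = ∀ k → k ∈Δ n → β k x

  record IsStrongInclusion (_⊑_ : ℕ → ℕ → Set) : Set where
    field
      ⊑-dom   : ∀ {a b} → a ⊑ b → domβ̂ a × domβ̂ b
      ⊑-trans : ∀ {a b c} → a ⊑ b → b ⊑ c → a ⊑ c
      ⊑-⊆     : ∀ {a b} → a ⊑ b → ∀ x → β̂ a x → β̂ b x

  IsStrongNbhdBasis : (ℕ → ℕ → Set) → (ℕ → Set) → X → Set
  IsStrongNbhdBasis _⊑_ S x =
    (∀ b → S b → domβ̂ b × β̂ b x) ×
    (∀ b₁ → domβ̂ b₁ → β̂ b₁ x → ∃ λ b₂ → S b₂ × (b₂ ⊑ b₁))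

  HasStrongNbhdBases : (ℕ → ℕ → Set) → Set₁
  HasStrongNbhdBases _⊑_ = ∀ x → ∃ λ (S : ℕ → Set) → IsStrongNbhdBasis _⊑_ S x

  ρmax : MultiRep X
  ρmax f x = ∀ n → (Im f n → dom n × β n x) × (dom n × β n x → Im f n)

  ρ⊑ : (ℕ → ℕ → Set) → MultiRep X
  ρ⊑ _⊑_ f x = IsStrongNbhdBasis _⊑_ (Im f) x

subspace : {X : Set} → NumberedSubbasis X → (A : X → Set) → NumberedSubbasis (Σ X A)
subspace B A = record
  { dom = NumberedSubbasis.dom B
  ; β   = λ n y → NumberedSubbasis.β B n (proj₁ y) }

-- Type-2 computability: partial recursive functions relative to an
-- oracle p : ℕ → ℕ (μ-recursive codes with an oracle basic function).

data Code : ℕ → Set where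
  zer  : ∀ {n} → Code n
  sucC : Code 1
  proj : ∀ {n} → Fin n → Code n
  orc  : Code 1
  comp : ∀ {n m} → Code m → Vec (Code n) m → Code n
  prec : ∀ {n} → Code n → Code (suc (suc n)) → Code (suc n)
  mu   : ∀ {n} → Code (suc n) → Code n

mutual
  data Eval (p : Baire) : ∀ {n} → Code n → Vec ℕ n → ℕ → Set where
    ev-zer  : ∀ {n} {xs : Vec ℕ n} → Eval p zer xs 0
    ev-suc  : ∀ {x} → Eval p sucC (x ∷ []) (suc x)
    ev-proj : ∀ {n} {xs : Vec ℕ n} {i} → Eval p (proj i) xs (lookup xs i)
    ev-orc  : ∀ {x} → Eval p orc (x ∷ []) (p x)
    ev-comp : ∀ {n m} {f : Code m} {gs : Vec (Code n) m} {xs ys y} →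
              EvalAll p gs xs ys → Eval p f ys y → Eval p (comp f gs) xs y
    ev-prec-z : ∀ {n} {g : Code n} {h xs y} →
                Eval p g xs y → Eval p (prec g h) (0 ∷ xs) y
    ev-prec-s : ∀ {n} {g : Code n} {h xs k r y} →
                Eval p (prec g h) (k ∷ xs) r → Eval p h (k ∷ r ∷ xs) y →
                Eval p (prec g h) (suc k ∷ xs) y
    ev-mu   : ∀ {n} {f : Code (suc n)} {xs y} →
              Eval p f (y ∷ xs) 0 →
              (∀ z → z < y → ∃ λ r → Eval p f (z ∷ xs) (suc r)) →
              Eval p (mu f) xs y

  data EvalAll (p : Baire) {n : ℕ} : ∀ {m} → Vec (Code n) m → Vec ℕ n → Vec ℕ m → Set where
    []  : ∀ {xs} → EvalAll p [] xs []
    _∷_ : ∀ {m} {g : Code n} {gs : Vec (Code n) m} {xs y ys} →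
          Eval p g xs y → EvalAll p gs xs ys → EvalAll p (g ∷ gs) xs (y ∷ ys)

-- ρ₁ ≤ ρ₂ : the identity is computable from ρ₁ to ρ₂, i.e. there is a
-- computable F (given by an oracle program e, F(p)(n) = φ_e^p(n)) defined on
-- dom ρ₁ such that every point named by p under ρ₁ is named by F(p) under ρ₂.
_≤ᵣ_ : {Y : Set} → MultiRep Y → MultiRep Y → Set
_≤ᵣ_ {Y} ρ₁ ρ₂ = Σ (Code 1) λ e → ∀ (p : Baire) → (∃ λ (y : Y) → ρ₁ p y) →
  Σ Baire λ q → (∀ n → Eval p e (n ∷ []) (q n)) × (∀ y → ρ₁ p y → ρ₂ q y)

_≡ᵣ_ : {Y : Set} → MultiRep Y → MultiRep Y → Set
ρ₁ ≡ᵣ ρ₂ = (ρ₁ ≤ᵣ ρ₂) × (ρ₂ ≤ᵣ ρ₁)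

{-# OPTIONS --safe #-}
module Submission where

open import Defs
open import Data.Nat using (ℕ)
open import Data.Product using (Σ; _×_; _,_)

-- The oracle program `orc` computes the identity on Baire space.
≤ᵣ-refl : {Y : Set} {ρ : MultiRep Y} → ρ ≤ᵣ ρ
≤ᵣ-refl = orc , λ p _ → p , (λ n → ev-orc) , (λ y ρpy → ρpy)

≡ᵣ-refl : {Y : Set} {ρ : MultiRep Y} → ρ ≡ᵣ ρ
≡ᵣ-refl = ≤ᵣ-refl , ≤ᵣ-refl

-- For y ∈ A, y ∈ α(n) = A ∩ β(n) iff y ∈ β(n), so both sides name the same
-- points and agree definitionally.
proposition4p2 : (X : Set) (B : NumberedSubbasis X) (_⊑_ : ℕ → ℕ → Set)
    → IsStrongInclusion B _⊑_
    → HasStrongNbhdBases B _⊑_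
    → (A : X → Set)
    → (ρmax (subspace B A) ≡ᵣ restrict (ρmax B) A)
    × (ρ⊑ (subspace B A) _⊑_ ≡ᵣ restrict (ρ⊑ B _⊑_) A)
proposition4p2 X B _⊑_ _ _ A = ≡ᵣ-refl , ≡ᵣ-refl
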